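{- Let $T$ be an out-branching of a digraph $D$. Then $T$ is minimal if and only if for every arc $(u,v)\in A(D)\setminus A(T)$ which is not $T$-backward, the vertex $u$ is an internal vertex of $T$ or $d^+_T(p(v))=1$.
   Context: Digraphs are finite, without loops or parallel arcs. An out-branching of $D$ is a spanning subgraph that is an oriented tree with exactly one vertex of in-degree zero (the root); leaves are vertices of out-degree zero in it, other vertices are internal. For a non-root vertex $v$, $p(v)$ denotes its parent (unique in-neighbour) in $T$, and $d^+_T$ denotes out-degree in $T$. For an arc $(u,v)\in A(D)\setminus A(T)$, the 1-change for $(u,v)$ is the operation of adding $(u,v)$ to $T$ and removing $(p(v),v)$. $T$ is minimal if no 1-change for an arc of $A(D)\setminus A(T)$ yields an out-branching with fewer leaves. For distinct vertices $x,y$, write $x<_T y$ if $T$ contains a path from $x$ to $y$; an arc $(y,x)\in A(D)\setminus A(T)$ is $T$-backward if $x<_T y$. -}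

module Defs where

open import Data.Nat using (ℕ; zero; suc; _+_; _≤_; _<_)
open import Data.Bool using (Bool; true; false; if_then_else_)
open import Data.Fin using (Fin; _≟_)
open import Data.List using (List; []; _∷_; _++_; [_]; length; map; allFin)
open import Data.Nat.ListAction using (sum)
open import Data.List.Relation.Unary.Linked using (Linked)
open import Data.List.Relation.Unary.Unique.Propositional using (Unique)
open import Data.Product using (Σ; _×_; ∃; ∃-syntax)
open import Data.Sum using (_⊎_)
open import Relation.Nullary using (¬_)
open import Relation.Nullary.Decidable using (⌊_⌋)
open import Relation.Binary.PropositionalEquality using (_≡_; _≢_)

-- A digraph on vertex set Fin n: arc relation given by a Bool-valued function.
-- No parallel arcs is automatic; loops are excluded by `loopless`.
record Digraph (n : ℕ) : Set where
  field
    arc      : Fin n → Fin n → Bool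
    loopless : ∀ v → arc v v ≡ false
open Digraph public

-- A spanning subgraph on the same vertex set is given by its arc set.
ArcSet : ℕ → Set
ArcSet n = Fin n → Fin n → Bool

module _ {n : ℕ} (T : ArcSet n) where

  indicator : Bool → ℕ
  indicator true  = 1
  indicator false = 0

  outdeg : Fin n → ℕ
  outdeg u = sum (map (λ v → indicator (T u v)) (allFin n))

  indeg : Fin n → ℕ
  indeg v = sum (map (λ u → indicator (T u v)) (allFin n))

  IsLeaf : Fin n → Set
  IsLeaf v = outdeg v ≡ 0

  IsInternal : Fin n → Set
  IsInternal v = outdeg v ≢ 0

  leaves : ℕ
  leaves = sum (map (λ v → indicator ⌊ outdeg v Data.Nat.≟ 0 ⌋) (allFin n))

  Adj : Fin n → Fin n → Set
  Adj u v = (T u v ≡ true) ⊎ (T v u ≡ true)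

  data UWalk : Fin n → Fin n → Set where
    here : ∀ {x} → UWalk x x
    step : ∀ {x y z} → Adj x y → UWalk y z → UWalk x z

  Connected : Set
  Connected = ∀ x y → UWalk x y

  HasCycle : Set
  HasCycle = Σ (Fin n) λ x → Σ (List (Fin n)) λ xs →
    (2 ≤ length xs) × Unique (x ∷ xs) × Linked Adj (x ∷ xs ++ [ x ])

  Oriented : Set
  Oriented = ∀ u v → T u v ≡ true → T v u ≡ false

  IsOrientedTree : Set
  IsOrientedTree = Oriented × Connected × ¬ HasCycle

  UniqueSource : Set
  UniqueSource = Σ (Fin n) λ r → (indeg r ≡ 0) × (∀ v → indeg v ≡ 0 → v ≡ r)

  data Path : Fin n → Fin n → Set where
    here : ∀ {x} → Path x x
    step : ∀ {x y z} → T x y ≡ true → Path y z → Path x z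

  _<T_ : Fin n → Fin n → Set
  x <T y = (x ≢ y) × Path x y

IsOutBranching : ∀ {n} → Digraph n → ArcSet n → Set
IsOutBranching D T =
  (∀ u v → T u v ≡ true → arc D u v ≡ true) × IsOrientedTree T × UniqueSource T

-- the 1-change for (u,v): add (u,v), remove (p(v),v).  Since p(v) is the
-- unique in-neighbour of v in T, this is: the in-arcs of v become exactly (u,v).
oneChange : ∀ {n} → ArcSet n → Fin n → Fin n → ArcSet n
oneChange T u v a b = if ⌊ b ≟ v ⌋ then ⌊ a ≟ u ⌋ else T a b

IsBackward : ∀ {n} → ArcSet n → Fin n → Fin n → Set
IsBackward T y x = _<T_ T x y

Minimal : ∀ {n} → Digraph n → ArcSet n → Set
Minimal D T = ∀ u v → arc D u v ≡ true → T u v ≡ false →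
  IsOutBranching D (oneChange T u v) → ¬ (leaves (oneChange T u v) < leaves T)

-- the characterising condition; p(v) is the (unique) in-neighbour of v in T
Condition : ∀ {n} → Digraph n → ArcSet n → Set
Condition D T = ∀ u v → arc D u v ≡ true → T u v ≡ false → ¬ IsBackward T u v →
  IsInternal T u ⊎ (Σ _ λ p → (T p v ≡ true) × (outdeg T p ≡ 1))

-- An out-branching is the same thing as an arborescence: an arc set with a source r from
-- which every vertex is reachable and in which no vertex has two parents.  Walking from a
-- vertex to its parents never revisits a vertex, since that would close a cycle, so the walk
-- ends at the unique source; two parents of one vertex would join two such walks into a cycle.
-- Conversely, in an arborescence no nonempty vertex set gives every member a parent inside
-- the set, as such a set would contain all ancestors of its members, hence r.  The vertices
-- of a cycle, of two opposite arcs, and (after the 1-change for (u,v)) the T-descendants of v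
-- when v is a T-ancestor of u would be such sets.  So the 1-change for (u,v) yields an
-- out-branching iff v is neither the root nor a T-ancestor of u.
--
-- The 1-change alters out-degrees only at u, which gains the child v, and at p = p(v), which
-- loses it.  Writing ℓ and ℓ′ for the leaf indicators before and after the change,
-- leaves T + ℓ′(u) + ℓ′(p) = leaves T′ + ℓ(u) + ℓ(p) with ℓ′(u) = ℓ(p) = 0, so the change
-- loses a leaf exactly when u is a leaf and p keeps another child.

module Submission where

open import Defs
open import Data.Bool using (true; false)
open import Data.Bool.Properties using (¬-not)
open import Data.Empty using (⊥; ⊥-elim)
open import Data.Unit using (⊤)
open import Data.Fin using (Fin; _≟_)
open import Data.Fin.Properties using (injective⇒≤)
import Data.Fin as Fin
open import Data.List
  using (List; []; _∷_; _++_; [_]; length; map; allFin; reverse; lookup; initLast; _∷ʳ′_)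
open import Data.List.Properties using (++-assoc; unfold-reverse; reverse-++; map-cong-local)
open import Data.List.Membership.Propositional using (_∈_; _∉_)
open import Data.List.Membership.Propositional.Properties
  using (∈-allFin; ∈-∃++; ∈-++⁺ˡ; ∈-++⁺ʳ; ∈-lookup)
open import Data.List.Relation.Binary.Permutation.Propositional using (_↭_; ↭-refl; ↭-sym; ↭⇒↭ₛ)
open import Data.List.Relation.Binary.Permutation.Propositional.Properties
  using (shift; ++-comm; ↭-reverse; ↭-length; ∈-resp-↭)
open import Data.List.Relation.Binary.Permutation.Setoid.Properties using (Unique-resp-↭)
open import Data.List.Relation.Unary.All as All using (All; []; _∷_)
open import Data.List.Relation.Unary.All.Properties using (¬Any⇒All¬; ++⁻ˡ)
open import Data.List.Relation.Unary.AllPairs using ([]; _∷_)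
open import Data.List.Relation.Unary.Any using (here; there)
open import Data.List.Relation.Unary.Any.Properties using (reverse⁺)
open import Data.List.Relation.Unary.Linked using (Linked; []; [-]; _∷_)
open import Data.List.Relation.Unary.Unique.Propositional using (Unique)
open import Data.List.Relation.Unary.Unique.Propositional.Properties
  using (allFin⁺; Unique[x∷xs]⇒x∉xs)
open import Data.Nat as ℕ using (ℕ; zero; suc; _+_; _≤_; _<_; z≤n; s≤s)
open import Data.Nat.ListAction using (sum)
open import Data.Nat.Properties
  using ( +-assoc; +-comm; +-identityʳ; +-suc; suc-injective; m+n≡0⇒m≡0; m+n≡0⇒n≡0
        ; ≤-refl; ≤-reflexive; <⇒≱; m≤n+m; +-monoʳ-≤; +-cancelʳ-≤; module ≤-Reasoning )
open import Data.Nat.Tactic.RingSolver using (solve-∀)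
open import Data.Product using (Σ; Σ-syntax; _×_; _,_; proj₁; proj₂)
open import Data.Sum using (_⊎_; inj₁; inj₂)
open import Function.Base using (_∘_; case_of_)
open import Function.Bundles using (_⇔_; mk⇔)
open import Relation.Binary.PropositionalEquality
  using (_≡_; _≢_; refl; sym; trans; cong; cong₂; subst; setoid; module ≡-Reasoning)
open import Relation.Nullary using (¬_; yes; no)
open import Relation.Nullary.Decidable using (⌊_⌋; toSum)

module _ {A : Set} {R : A → A → Set} where

  Linked-++⁻ : ∀ xs {y ys} → Linked R (xs ++ y ∷ ys) → Linked R (xs ++ [ y ]) × Linked R (y ∷ ys)
  Linked-++⁻ []               l       = [-] , l
  Linked-++⁻ (x ∷ [])         (r ∷ l) = r ∷ [-] , l
  Linked-++⁻ (x ∷ xs@(_ ∷ _)) (r ∷ l) = let l₁ , l₂ = Linked-++⁻ xs l in r ∷ l₁ , l₂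

  Linked-++⁺ : ∀ xs {y ys} → Linked R (xs ++ [ y ]) → Linked R (y ∷ ys) → Linked R (xs ++ y ∷ ys)
  Linked-++⁺ []               _             l₂ = l₂
  Linked-++⁺ (x ∷ [])         (r ∷ [-])     l₂ = r ∷ l₂
  Linked-++⁺ (x ∷ xs@(_ ∷ _)) (r ∷ l₁)      l₂ = r ∷ Linked-++⁺ xs l₁ l₂

  Linked-reverse : (∀ {a b} → R a b → R b a) → ∀ xs → Linked R xs → Linked R (reverse xs)
  Linked-reverse R-sym []           l       = l
  Linked-reverse R-sym (x ∷ [])     l       = l
  Linked-reverse R-sym (x ∷ y ∷ xs) (r ∷ l) =
    subst (Linked R) (sym reverse-x∷y∷xs)
      (Linked-++⁺ (reverse xs) {y} {[ x ]}
        (subst (Linked R) (unfold-reverse y xs) (Linked-reverse R-sym (y ∷ xs) l))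
        (R-sym r ∷ [-]))
    where
    reverse-x∷y∷xs : reverse (x ∷ y ∷ xs) ≡ reverse xs ++ y ∷ [ x ]
    reverse-x∷y∷xs = trans (unfold-reverse x (y ∷ xs))
      (trans (cong (_++ [ x ]) (unfold-reverse y xs)) (++-assoc (reverse xs) [ y ] [ x ]))

module _ {A : Set} where

  ∈⇒≢ : ∀ {x a} {xs : List A} → All (x ≢_) xs → a ∈ xs → a ≢ x
  ∈⇒≢ x∉ a∈ a≡x = All.lookup x∉ a∈ (sym a≡x)

  Unique-↭ : ∀ {xs ys : List A} → xs ↭ ys → Unique xs → Unique ys
  Unique-↭ p = Unique-resp-↭ (setoid A) (↭⇒↭ₛ p)

  Unique-++⁻ˡ : ∀ (xs : List A) {ys} → Unique (xs ++ ys) → Unique xs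
  Unique-++⁻ˡ []       _          = []
  Unique-++⁻ˡ (x ∷ xs) (x∉ ∷ u)   = ++⁻ˡ xs x∉ ∷ Unique-++⁻ˡ xs u

  Unique-extract : ∀ (xs : List A) {y ys} → Unique (xs ++ y ∷ ys) → Unique (y ∷ xs)
  Unique-extract xs {y} {ys} u = Unique-++⁻ˡ (y ∷ xs) (Unique-↭ (shift y xs ys) u)

  Unique-lookup-injective : ∀ {xs : List A} → Unique xs → ∀ {i j} → lookup xs i ≡ lookup xs j → i ≡ j
  Unique-lookup-injective (x∉ ∷ u) {Fin.zero}  {Fin.zero}  _ = refl
  Unique-lookup-injective (x∉ ∷ u) {Fin.zero}  {Fin.suc j} e = ⊥-elim (All.lookup x∉ (∈-lookup j) e)
  Unique-lookup-injective (x∉ ∷ u) {Fin.suc i} {Fin.zero}  e = ⊥-elim (All.lookup x∉ (∈-lookup i) (sym e))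
  Unique-lookup-injective (x∉ ∷ u) {Fin.suc i} {Fin.suc j} e = cong Fin.suc (Unique-lookup-injective u e)

Unique-length≤ : ∀ {n} {xs : List (Fin n)} → Unique xs → length xs ≤ n
Unique-length≤ u = injective⇒≤ (Unique-lookup-injective u)

private
  +-exchange : ∀ a s b → a + s + b ≡ b + s + a
  +-exchange = solve-∀

  +-shuffleˡ : ∀ a s b c → a + s + (b + c) ≡ a + b + (s + c)
  +-shuffleˡ = solve-∀

  +-shuffleʳ : ∀ a b s c → a + b + (s + c) ≡ b + s + (a + c)
  +-shuffleʳ = solve-∀

module _ {A : Set} (f g : A → ℕ) where

  sum-cong-∈ : ∀ {xs} → (∀ {a} → a ∈ xs → f a ≡ g a) → sum (map f xs) ≡ sum (map g xs)
  sum-cong-∈ agree = cong sum (map-cong-local (All.tabulate agree))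

  sum-update : ∀ {u xs} → Unique xs → u ∈ xs → (∀ {a} → a ∈ xs → a ≢ u → f a ≡ g a) →
               sum (map f xs) + g u ≡ sum (map g xs) + f u
  sum-update {xs = x ∷ xs} (x∉ ∷ _) (here refl) agree = begin
    f x + sum (map f xs) + g x  ≡⟨ cong (λ s → f x + s + g x) rest ⟩
    f x + sum (map g xs) + g x  ≡⟨ +-exchange (f x) _ (g x) ⟩
    g x + sum (map g xs) + f x  ∎
    where
    open ≡-Reasoning
    rest : sum (map f xs) ≡ sum (map g xs)
    rest = sum-cong-∈ (λ a∈ → agree (there a∈) (∈⇒≢ x∉ a∈))
  sum-update {xs = x ∷ xs} (x∉ ∷ uq) (there u∈) agree =
    trans (+-assoc (f x) _ _)
      (trans (cong₂ _+_ (agree (here refl) (All.lookup x∉ u∈)) (sum-update uq u∈ (agree ∘ there)))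
        (sym (+-assoc (g x) _ _)))

  private
    sum-update-head : ∀ {x p xs} → Unique (x ∷ xs) → p ∈ xs →
                      (∀ {a} → a ∈ xs → a ≢ p → f a ≡ g a) →
                      sum (map f (x ∷ xs)) + (g x + g p) ≡ sum (map g (x ∷ xs)) + (f x + f p)
    sum-update-head {x} {p} {xs} (_ ∷ uq) p∈ agree = begin
      f x + F + (g x + g p)  ≡⟨ +-shuffleˡ (f x) F (g x) (g p) ⟩
      f x + g x + (F + g p)  ≡⟨ cong (f x + g x +_) (sum-update uq p∈ agree) ⟩
      f x + g x + (G + f p)  ≡⟨ +-shuffleʳ (f x) (g x) G (f p) ⟩
      g x + G + (f x + f p)  ∎
      where
      open ≡-Reasoning
      F G : ℕ
      F = sum (map f xs)
      G = sum (map g xs)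

  sum-update₂ : ∀ {u p xs} → Unique xs → u ∈ xs → p ∈ xs → u ≢ p →
                (∀ {a} → a ∈ xs → a ≢ u → a ≢ p → f a ≡ g a) →
                sum (map f xs) + (g u + g p) ≡ sum (map g xs) + (f u + f p)
  sum-update₂ _ (here refl) (here refl) u≢p _ = ⊥-elim (u≢p refl)
  sum-update₂ uq@(x∉ ∷ _) (here refl) (there p∈) _ agree =
    sum-update-head uq p∈ (λ a∈ → agree (there a∈) (∈⇒≢ x∉ a∈))
  sum-update₂ {u} {p} {xs} uq@(x∉ ∷ _) (there u∈) (here refl) _ agree =
    trans (cong (sum (map f xs) +_) (+-comm (g u) (g p)))
      (trans (sum-update-head uq u∈ (λ a∈ a≢u → agree (there a∈) a≢u (∈⇒≢ x∉ a∈)))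
        (cong (sum (map g xs) +_) (+-comm (f p) (f u))))
  sum-update₂ {xs = x ∷ xs} (x∉ ∷ uq) (there u∈) (there p∈) u≢p agree =
    trans (+-assoc (f x) _ _)
      (trans (cong₂ _+_ (agree (here refl) (All.lookup x∉ u∈) (All.lookup x∉ p∈))
                        (sum-update₂ uq u∈ p∈ u≢p (agree ∘ there)))
        (sym (+-assoc (g x) _ _)))

module _ {A : Set} (f : A → ℕ) where

  sum-≢0 : ∀ {x xs} → x ∈ xs → f x ≢ 0 → sum (map f xs) ≢ 0
  sum-≢0 {xs = y ∷ ys} (here refl) fx≢0 s≡0 = fx≢0 (m+n≡0⇒m≡0 (f y) s≡0)
  sum-≢0 {xs = y ∷ ys} (there x∈) fx≢0 s≡0 = sum-≢0 x∈ fx≢0 (m+n≡0⇒n≡0 (f y) s≡0)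

  sum-≢0⇒witness : ∀ xs → sum (map f xs) ≢ 0 → Σ[ x ∈ A ] f x ≢ 0
  sum-≢0⇒witness []       s≢0 = ⊥-elim (s≢0 refl)
  sum-≢0⇒witness (y ∷ ys) s≢0 with f y ℕ.≟ 0
  ... | no fy≢0 = y , fy≢0
  ... | yes fy≡0 = sum-≢0⇒witness ys (λ s≡0 → s≢0 (cong₂ _+_ fy≡0 s≡0))

module _ {n} {S : ArcSet n} where

  _▻_ : ∀ {x y z} → Path S x y → S y z ≡ true → Path S x z
  here      ▻ yz = step yz here
  step xy p ▻ yz = step xy (p ▻ yz)

  Path-unsnoc : ∀ {x z} → Path S x z → x ≡ z ⊎ Σ[ y ∈ Fin n ] (Path S x y × S y z ≡ true)
  Path-unsnoc here = inj₁ refl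
  Path-unsnoc {x} (step xy p) with Path-unsnoc p
  ... | inj₁ refl          = inj₂ (x , here , xy)
  ... | inj₂ (y , q , yz)  = inj₂ (y , step xy q , yz)

  Adj-sym : ∀ {x y} → Adj S x y → Adj S y x
  Adj-sym (inj₁ xy) = inj₂ xy
  Adj-sym (inj₂ yx) = inj₁ yx

  UWalk-++ : ∀ {x y z} → UWalk S x y → UWalk S y z → UWalk S x z
  UWalk-++ here       w = w
  UWalk-++ (step a v) w = step a (UWalk-++ v w)

  UWalk-reverse : ∀ {x y} → UWalk S x y → UWalk S y x
  UWalk-reverse here       = here
  UWalk-reverse (step a w) = UWalk-++ (UWalk-reverse w) (step (Adj-sym a) here)

  Path⇒UWalk : ∀ {x y} → Path S x y → UWalk S x y
  Path⇒UWalk here        = here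
  Path⇒UWalk (step xy p) = step (inj₁ xy) (Path⇒UWalk p)

  indicator-true : ∀ {b} → indicator S b ≢ 0 → b ≡ true
  indicator-true {true}  _   = refl
  indicator-true {false} ≢0 = ⊥-elim (≢0 refl)

  indicator-≢0 : ∀ {b} → b ≡ true → indicator S b ≢ 0
  indicator-≢0 refl ()

  indeg-≢0 : ∀ {a b} → S a b ≡ true → indeg S b ≢ 0
  indeg-≢0 {a} ab = sum-≢0 _ (∈-allFin a) (indicator-≢0 ab)

  outdeg-≢0 : ∀ {a b} → S a b ≡ true → outdeg S a ≢ 0
  outdeg-≢0 {b = b} ab = sum-≢0 _ (∈-allFin b) (indicator-≢0 ab)

  indeg-≢0⇒parent : ∀ {b} → indeg S b ≢ 0 → Σ[ a ∈ Fin n ] S a b ≡ true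
  indeg-≢0⇒parent ≢0 = let a , i≢0 = sum-≢0⇒witness _ (allFin n) ≢0 in a , indicator-true i≢0

arc≢nonarc : ∀ {n} {S : ArcSet n} {p u v} → S p v ≡ true → S u v ≡ false → p ≢ u
arc≢nonarc pv uv∉S refl with trans (sym pv) uv∉S
... | ()

-- `indicator` is declared in a module parametrised by an arc set that it does not use.
indicator-irrelevant : ∀ {n} (S S′ : ArcSet n) b → indicator S b ≡ indicator S′ b
indicator-irrelevant _ _ true  = refl
indicator-irrelevant _ _ false = refl

UniqueParents : ∀ {n} → ArcSet n → Set
UniqueParents S = ∀ {a b c} → S a c ≡ true → S b c ≡ true → a ≡ b

record Arborescence {n} (S : ArcSet n) : Set where
  field
    root          : Fin n
    root-source   : indeg S root ≡ 0
    reach         : ∀ x → Path S root x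
    parent-unique : UniqueParents S

module _ {n} {T : ArcSet n} (oriented : Oriented T) (acyclic : ¬ HasCycle T) where

  open import Data.List.Membership.DecPropositional (_≟_ {n}) using (_∈?_)

  no-2-cycle : ∀ {a b} → T a b ≡ true → T b a ≡ true → ⊥
  no-2-cycle ab ba with trans (sym ba) (oriented _ _ ab)
  ... | ()

  back-edge-closes-cycle : ∀ {y h h′ t} → y ∈ t → Adj T y h →
                           Unique (h ∷ h′ ∷ t) → Linked (Adj T) (h ∷ h′ ∷ t) → HasCycle T
  back-edge-closes-cycle {y} {h} {h′} y∈t yh uq l with ∈-∃++ y∈t
  ... | p , _ , refl = y , h ∷ h′ ∷ p , s≤s (s≤s z≤n) , Unique-extract (h ∷ h′ ∷ p) uq ,
                       yh ∷ proj₁ (Linked-++⁻ (h ∷ h′ ∷ p) l)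

  ChildFirst : Fin n → List (Fin n) → Set
  ChildFirst h []       = ⊤
  ChildFirst h (h′ ∷ _) = T h h′ ≡ true

  parent-off-trail : ∀ {y h t} → T y h ≡ true → ChildFirst h t →
                     Unique (h ∷ t) → Linked (Adj T) (h ∷ t) → y ∉ h ∷ t
  parent-off-trail yh _  _  _ (here refl)         = no-2-cycle yh yh
  parent-off-trail yh hy _  _ (there (here refl)) = no-2-cycle hy yh
  parent-off-trail yh _  uq l (there (there y∈))  = acyclic (back-edge-closes-cycle y∈ (inj₁ yh) uq l)

  -- The simple trail h ∷ t, extended backwards through the ancestors of h up to a source.
  record RootwardTrail (h : Fin n) (t : List (Fin n)) : Set where
    field
      prefix      : List (Fin n)
      root        : Fin n
      root-source : indeg T root ≡ 0
      root⇝h      : Path T root h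
      root∉t      : root ∉ t
      root∈prefix : root ∈ prefix ++ [ h ]
      unique      : Unique (prefix ++ h ∷ t)
      linked      : Linked (Adj T) (prefix ++ h ∷ t)

  extend : ∀ {y h t} → T y h ≡ true → RootwardTrail y (h ∷ t) → RootwardTrail h t
  extend {y} {h} {t} yh tr = record
    { prefix      = prefix ++ [ y ]
    ; root        = root
    ; root-source = root-source
    ; root⇝h      = root⇝h ▻ yh
    ; root∉t      = root∉t ∘ there
    ; root∈prefix = ∈-++⁺ˡ root∈prefix
    ; unique      = subst Unique (sym reassoc) unique
    ; linked      = subst (Linked (Adj T)) (sym reassoc) linked
    }
    where
    open RootwardTrail tr
    reassoc : (prefix ++ [ y ]) ++ h ∷ t ≡ prefix ++ y ∷ h ∷ t
    reassoc = ++-assoc prefix [ y ] (h ∷ t)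

  rootward : ∀ fuel h t → n < length (h ∷ t) + fuel →
             Unique (h ∷ t) → Linked (Adj T) (h ∷ t) → ChildFirst h t → RootwardTrail h t
  rootward zero h t enough uq _ _ =
    ⊥-elim (<⇒≱ (subst (n <_) (+-identityʳ _) enough) (Unique-length≤ uq))
  rootward (suc fuel) h t enough uq l hh′ with indeg T h ℕ.≟ 0
  ... | yes h-source = record
    { prefix = [] ; root = h ; root-source = h-source ; root⇝h = here
    ; root∉t = Unique[x∷xs]⇒x∉xs uq ; root∈prefix = here refl ; unique = uq ; linked = l }
  ... | no h-nonsource =
    let y , yh = indeg-≢0⇒parent {S = T} h-nonsource
        y∉ = parent-off-trail yh hh′ uq l
    in extend yh (rootward fuel y (h ∷ t) (subst (n <_) (+-suc _ fuel) enough)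
                   (¬Any⇒All¬ _ y∉ ∷ uq) (inj₁ yh ∷ l) yh)

  rootwardFrom : ∀ h t → Unique (h ∷ t) → Linked (Adj T) (h ∷ t) → ChildFirst h t → RootwardTrail h t
  rootwardFrom h t = rootward n h t (s≤s (m≤n+m n (length t)))

  trail-to-source : ∀ {a v} → T a v ≡ true →
                    Σ[ R ∈ List (Fin n) ] Σ[ z ∈ Fin n ] indeg T z ≡ 0 × z ∈ a ∷ R ×
                    Unique (v ∷ a ∷ R) × Linked (Adj T) (v ∷ a ∷ R)
  trail-to-source {a} {v} av = reverse prefix , root , root-source , root∈ , uq , l
    where
    a≢v : a ≢ v
    a≢v refl = no-2-cycle av av
    open RootwardTrail (rootwardFrom a [ v ] ((a≢v ∷ []) ∷ [] ∷ []) (inj₁ av ∷ [-]) av)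
    reversed : reverse (prefix ++ a ∷ v ∷ []) ≡ v ∷ a ∷ reverse prefix
    reversed = reverse-++ prefix (a ∷ v ∷ [])
    uq : Unique (v ∷ a ∷ reverse prefix)
    uq = subst Unique reversed (Unique-↭ (↭-sym (↭-reverse _)) unique)
    l : Linked (Adj T) (v ∷ a ∷ reverse prefix)
    l = subst (Linked (Adj T)) reversed (Linked-reverse (Adj-sym {S = T}) _ linked)
    root∈ : root ∈ a ∷ reverse prefix
    root∈ = subst (root ∈_) (reverse-++ prefix [ a ]) (reverse⁺ root∈prefix)

  acyclic⇒uniqueParents : (∀ {z z′} → indeg T z ≡ 0 → indeg T z′ ≡ 0 → z ≡ z′) →
                          UniqueParents T
  acyclic⇒uniqueParents one-source {a} {b} {v} av bv with a ≟ b | trail-to-source av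
  ... | yes a≡b | _ = a≡b
  ... | no a≢b | R , z , z-source , z∈ , uq , l with b ∈? v ∷ a ∷ R
  ...   | yes (here refl)         = ⊥-elim (no-2-cycle bv bv)
  ...   | yes (there (here refl)) = ⊥-elim (a≢b refl)
  ...   | yes (there (there b∈))  = ⊥-elim (acyclic (back-edge-closes-cycle b∈ (inj₁ bv) uq l))
  ...   | no b∉ =
    ⊥-elim (root∉t (subst (_∈ v ∷ a ∷ R) (one-source z-source root-source) (there z∈)))
    where open RootwardTrail (rootwardFrom b (v ∷ a ∷ R) (¬Any⇒All¬ _ b∉ ∷ uq) (inj₁ bv ∷ l) bv)

  orientedTree⇒arborescence : UniqueSource T → Arborescence T
  orientedTree⇒arborescence (r , r-source , only-source) = record
    { root          = r
    ; root-source   = r-source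
    ; reach         = reach
    ; parent-unique = acyclic⇒uniqueParents λ z-source z′-source →
                        trans (only-source _ z-source) (sym (only-source _ z′-source))
    }
    where
    reach : ∀ x → Path T r x
    reach x = subst (λ w → Path T w x) (only-source root root-source) root⇝h
      where open RootwardTrail (rootwardFrom x [] ([] ∷ []) [-] _)

Unfounded : ∀ {n} → ArcSet n → (Fin n → Set) → Set
Unfounded {n} S P = ∀ {c} → P c → Σ[ a ∈ Fin n ] (S a c ≡ true × P a)

Cycle : ∀ {n} → ArcSet n → Fin n → List (Fin n) → Set
Cycle S x xs = 2 ≤ length xs × Unique (x ∷ xs) × Linked (Adj S) (x ∷ xs ++ [ x ])

rotate : ∀ {n} {S : ArcSet n} {c x xs} → c ∈ x ∷ xs → Cycle S x xs →
         Σ[ ws ∈ List (Fin n) ] (c ∷ ws ↭ x ∷ xs) × Cycle S c ws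
rotate (here refl) cyc = _ , ↭-refl , cyc
rotate {S = S} {c} {x} (there c∈) (len , uq , l) with ∈-∃++ c∈
... | as , bs , refl = bs ++ x ∷ as , ↭-sym swapped , len′ , Unique-↭ swapped uq , l′
  where
  swapped : (x ∷ as) ++ c ∷ bs ↭ (c ∷ bs) ++ x ∷ as
  swapped = ++-comm (x ∷ as) (c ∷ bs)
  len′ : 2 ≤ length (bs ++ x ∷ as)
  len′ = subst (2 ≤_) (suc-injective (↭-length swapped)) len
  halves : Linked (Adj S) ((x ∷ as) ++ [ c ]) × Linked (Adj S) (c ∷ bs ++ [ x ])
  halves = Linked-++⁻ (x ∷ as) (subst (Linked (Adj S)) (cong (x ∷_) (++-assoc as (c ∷ bs) [ x ])) l)
  l′ : Linked (Adj S) (c ∷ (bs ++ x ∷ as) ++ [ c ])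
  l′ = subst (Linked (Adj S)) (cong (c ∷_) (sym (++-assoc bs (x ∷ as) [ c ])))
         (Linked-++⁺ (c ∷ bs) (proj₂ halves) (proj₁ halves))

module _ {n} {S : ArcSet n} (A : Arborescence S) where

  open Arborescence A

  unfounded-empty : ∀ {P} → Unfounded S P → ∀ {c} → ¬ P c
  unfounded-empty {P} unfounded {c} c∈P with unfounded (ancestor (reach c) c∈P)
    where
    ancestor : ∀ {x y} → Path S x y → P y → P x
    ancestor here        y∈P = y∈P
    ancestor (step xz p) y∈P =
      let a , az , a∈P = unfounded (ancestor p y∈P) in subst P (parent-unique az xz) a∈P
  ... | _ , a-root , _ = indeg-≢0 {S = S} a-root root-source

  arc-propagates : ∀ {a b} ws {z} → Unique (a ∷ b ∷ ws ++ [ z ]) →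
                   Linked (Adj S) (b ∷ ws ++ [ z ]) → S a b ≡ true →
                   Σ[ p ∈ Fin n ] (p ∈ b ∷ ws × S p z ≡ true)
  arc-propagates []       _                         (inj₁ bz ∷ [-]) _  = _ , here refl , bz
  arc-propagates []       ((_ ∷ a≢z ∷ []) ∷ _)      (inj₂ zb ∷ [-]) ab =
    ⊥-elim (a≢z (parent-unique ab zb))
  arc-propagates (c ∷ ws) (_ ∷ uq)                  (inj₁ bc ∷ l)   _  =
    let p , p∈ , pz = arc-propagates ws uq l bc in p , there p∈ , pz
  arc-propagates (c ∷ ws) ((_ ∷ a≢c ∷ _) ∷ _)       (inj₂ cb ∷ _)   ab =
    ⊥-elim (a≢c (parent-unique ab cb))

  -- If neither cycle neighbour of c is its parent, then c → w for the next vertex w, and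
  -- uniqueness of parents forces every following cycle arc forward; so the last vertex z gets
  -- a parent on the cycle besides c.
  cycle-head-has-parent : ∀ {c ws} → Cycle S c ws → Σ[ p ∈ Fin n ] (p ∈ ws × S p c ≡ true)
  cycle-head-has-parent {ws = w ∷ _}  (_ , _ , inj₂ wc ∷ _) = w , here refl , wc
  cycle-head-has-parent {c} {w ∷ ws} (len , uq , inj₁ cw ∷ l) with initLast ws
  ... | [] with len
  ...   | s≤s ()
  cycle-head-has-parent {c} {w ∷ _} (_ , uq@(c∉ ∷ _) , inj₁ cw ∷ l) | mid ∷ʳ′ z
      with Linked-++⁻ (w ∷ mid) (subst (Linked (Adj S)) (cong (w ∷_) (++-assoc mid [ z ] [ c ])) l)
  ... | _  , inj₁ zc ∷ [-] = z , there (∈-++⁺ʳ mid (here refl)) , zc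
  ... | l₁ , inj₂ cz ∷ [-] =
    let p , p∈ , pz = arc-propagates mid uq l₁ cw
    in ⊥-elim (All.lookup c∉ (∈-++⁺ˡ {ys = [ z ]} p∈) (sym (parent-unique pz cz)))

  arborescence-acyclic : ¬ HasCycle S
  arborescence-acyclic (x , xs , cyc) = unfounded-empty on-cycle (here refl)
    where
    on-cycle : Unfounded S (_∈ x ∷ xs)
    on-cycle c∈ = let ws , c∷ws↭ , cyc′ = rotate c∈ cyc
                      p , p∈ , pc = cycle-head-has-parent cyc′
                  in p , pc , ∈-resp-↭ c∷ws↭ (there p∈)

  arborescence-oriented : Oriented S
  arborescence-oriented a b ab with S b a in ba
  ... | false = refl
  ... | true  = ⊥-elim (unfounded-empty {P = λ x → x ≡ a ⊎ x ≡ b} mutual-parents (inj₁ refl))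
    where
    mutual-parents : Unfounded S (λ x → x ≡ a ⊎ x ≡ b)
    mutual-parents (inj₁ refl) = b , ba , inj₂ refl
    mutual-parents (inj₂ refl) = a , ab , inj₁ refl

  arborescence-connected : Connected S
  arborescence-connected x y =
    UWalk-++ (UWalk-reverse (Path⇒UWalk (reach x))) (Path⇒UWalk (reach y))

  parent-of-nonroot : ∀ {v} → v ≢ root → Σ[ p ∈ Fin n ] S p v ≡ true
  parent-of-nonroot {v} v≢root with Path-unsnoc (reach v)
  ... | inj₁ root≡v       = ⊥-elim (v≢root (sym root≡v))
  ... | inj₂ (p , _ , pv) = p , pv

  arborescence-uniqueSource : UniqueSource S
  arborescence-uniqueSource = root , root-source , only-source
    where
    only-source : ∀ v → indeg S v ≡ 0 → v ≡ root
    only-source v v-source with v ≟ root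
    ... | yes v≡root = v≡root
    ... | no v≢root  = ⊥-elim (indeg-≢0 {S = S} (proj₂ (parent-of-nonroot v≢root)) v-source)

  ¬above⇒≢root : ∀ {u v} → ¬ Path S v u → v ≢ root
  ¬above⇒≢root {u} v↛u refl = v↛u (reach u)

outBranching⇒arborescence : ∀ {n} {D : Digraph n} {T : ArcSet n} →
                            IsOutBranching D T → Arborescence T
outBranching⇒arborescence (_ , (oriented , _ , acyclic) , source) =
  orientedTree⇒arborescence oriented acyclic source

arborescence⇒outBranching : ∀ {n} {D : Digraph n} {T : ArcSet n} →
                            (∀ a b → T a b ≡ true → arc D a b ≡ true) →
                            Arborescence T → IsOutBranching D T
arborescence⇒outBranching T⊆D A =
  T⊆D , (arborescence-oriented A , arborescence-connected A , arborescence-acyclic A) ,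
  arborescence-uniqueSource A

module _ {n} (T : ArcSet n) (u v : Fin n) where

  private
    T′ = oneChange T u v

  oneChange-new : T′ u v ≡ true
  oneChange-new with v ≟ v | u ≟ u
  ... | yes _ | yes _  = refl
  ... | no v≢v | _     = ⊥-elim (v≢v refl)
  ... | yes _ | no u≢u = ⊥-elim (u≢u refl)

  oneChange-≢ : ∀ {a b} → b ≢ v → T′ a b ≡ T a b
  oneChange-≢ {b = b} b≢v with b ≟ v
  ... | yes b≡v = ⊥-elim (b≢v b≡v)
  ... | no _    = refl

  oneChange-into : ∀ {a} → a ≢ u → T′ a v ≡ false
  oneChange-into {a} a≢u with v ≟ v | a ≟ u
  ... | yes _  | no _    = refl
  ... | yes _  | yes a≡u = ⊥-elim (a≢u a≡u)
  ... | no v≢v | _       = ⊥-elim (v≢v refl)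

  oneChange-row : ∀ {a} → a ≢ u → T a v ≡ false → ∀ b → T′ a b ≡ T a b
  oneChange-row a≢u av b with toSum (b ≟ v)
  ... | inj₁ refl = trans (oneChange-into a≢u) (sym av)
  ... | inj₂ b≢v  = oneChange-≢ b≢v

  oneChange-arc : ∀ {a b} → T′ a b ≡ true → (a ≡ u × b ≡ v) ⊎ (b ≢ v × T a b ≡ true)
  oneChange-arc {a} {b} ab with b ≟ v | a ≟ u
  ... | yes b≡v | yes a≡u = inj₁ (a≡u , b≡v)
  ... | yes _   | no _    = case ab of λ ()
  ... | no b≢v  | _       = inj₂ (b≢v , ab)

  indeg-oneChange : ∀ {b} → b ≢ v → indeg T′ b ≡ indeg T b
  indeg-oneChange b≢v = sum-cong-∈ _ _ {allFin n} λ {a} _ →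
    trans (cong (indicator T′) (oneChange-≢ b≢v)) (indicator-irrelevant T′ T (T a _))

  outdeg-oneChange : ∀ {a} → a ≢ u → T a v ≡ false → outdeg T′ a ≡ outdeg T a
  outdeg-oneChange {a} a≢u av = sum-cong-∈ _ _ {allFin n} λ {b} _ →
    trans (cong (indicator T′) (oneChange-row a≢u av b)) (indicator-irrelevant T′ T (T a b))

  outdeg-oneChange-parent : ∀ {p} → p ≢ u → T p v ≡ true → outdeg T p ≡ suc (outdeg T′ p)
  outdeg-oneChange-parent {p} p≢u pv = begin
    outdeg T p                                ≡⟨ +-identityʳ _ ⟨
    outdeg T p + indicator T′ false           ≡⟨ cong (λ c → outdeg T p + indicator T′ c)
                                                        (oneChange-into p≢u) ⟨
    outdeg T p + indicator T′ (T′ p v)        ≡⟨ sum-update _ _ (allFin⁺ n) (∈-allFin v) row ⟩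
    outdeg T′ p + indicator T (T p v)         ≡⟨ cong (λ c → outdeg T′ p + indicator T c) pv ⟩
    outdeg T′ p + 1                           ≡⟨ +-comm (outdeg T′ p) 1 ⟩
    suc (outdeg T′ p)                         ∎
    where
    open ≡-Reasoning
    row : ∀ {b} → b ∈ allFin n → b ≢ v → indicator T (T p b) ≡ indicator T′ (T′ p b)
    row _ b≢v = trans (indicator-irrelevant T T′ _) (cong (indicator T′) (sym (oneChange-≢ b≢v)))

module _ {n} {T : ArcSet n} (A : Arborescence T) {u v : Fin n}
         (v↛u : ¬ Path T v u) (v≢root : v ≢ Arborescence.root A) where

  open Arborescence A

  private
    T′ = oneChange T u v

  path-avoiding-v : ∀ {a x} → Path T a x → ¬ Path T v x → Path T′ a x
  path-avoiding-v here _ = here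
  path-avoiding-v (step {y = y} ay p) v↛x with y ≟ v
  ... | yes refl = ⊥-elim (v↛x p)
  ... | no y≢v   = step (trans (oneChange-≢ T u v y≢v) ay) (path-avoiding-v p v↛x)

  root⇝′v : Path T′ root v
  root⇝′v = path-avoiding-v (reach u) v↛u ▻ oneChange-new T u v

  reroute : ∀ {a x} → Path T′ root a → Path T a x → Path T′ root x
  reroute root⇝′a here = root⇝′a
  reroute root⇝′a (step {y = y} ay p) with y ≟ v
  ... | yes refl = reroute root⇝′v p
  ... | no y≢v   = reroute (root⇝′a ▻ trans (oneChange-≢ T u v y≢v) ay) p

  oneChange-uniqueParents : UniqueParents T′
  oneChange-uniqueParents {a} {b} {c} ac bc
    with oneChange-arc T u v {a} {c} ac | oneChange-arc T u v {b} {c} bc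
  ... | inj₁ (refl , _)  | inj₁ (refl , _)  = refl
  ... | inj₁ (_ , refl)  | inj₂ (c≢v , _)   = ⊥-elim (c≢v refl)
  ... | inj₂ (c≢v , _)   | inj₁ (_ , refl)  = ⊥-elim (c≢v refl)
  ... | inj₂ (_ , ac′)   | inj₂ (_ , bc′)   = parent-unique ac′ bc′

  oneChange-arborescence : Arborescence T′
  oneChange-arborescence = record
    { root          = root
    ; root-source   = trans (indeg-oneChange T u v (v≢root ∘ sym)) root-source
    ; reach         = reroute here ∘ reach
    ; parent-unique = oneChange-uniqueParents
    }

module _ {n} {T : ArcSet n} {u v : Fin n} (A′ : Arborescence (oneChange T u v)) where

  oneChange-arborescence⇒¬above : ¬ Path T v u
  oneChange-arborescence⇒¬above v⇝u = unfounded-empty A′ below-v {v} here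
    where
    below-v : Unfounded (oneChange T u v) (Path T v)
    below-v {c} v⇝c with toSum (c ≟ v) | Path-unsnoc v⇝c
    ... | inj₁ refl | _                   = u , oneChange-new T u v , v⇝u
    ... | inj₂ c≢v  | inj₁ refl           = ⊥-elim (c≢v refl)
    ... | inj₂ c≢v  | inj₂ (y , v⇝y , yc) = y , trans (oneChange-≢ T u v c≢v) yc , v⇝y

  oneChange-arborescence⇒≢root : (A : Arborescence T) → v ≢ Arborescence.root A
  oneChange-arborescence⇒≢root A v≡root = root′≢v (trans root′≡root (sym v≡root))
    where
    open Arborescence A′ renaming (root to root′; root-source to root′-source)
    root′≢v : root′ ≢ v
    root′≢v refl = indeg-≢0 {S = oneChange T u v} (oneChange-new T u v) root′-source
    root′≡root : root′ ≡ Arborescence.root A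
    root′≡root = proj₂ (proj₂ (arborescence-uniqueSource A)) root′
                   (trans (sym (indeg-oneChange T u v root′≢v)) root′-source)

-- The summand of `leaves`, so that `leaves S` is `sum (map (leafIndicator S) (allFin n))`.
leafIndicator : ∀ {n} → ArcSet n → Fin n → ℕ
leafIndicator S a = indicator S ⌊ outdeg S a ℕ.≟ 0 ⌋

module _ {n} (S : ArcSet n) where

  leafIndicator-leaf : ∀ {a} → IsLeaf S a → leafIndicator S a ≡ 1
  leafIndicator-leaf leaf = subst (λ k → indicator S ⌊ k ℕ.≟ 0 ⌋ ≡ 1) (sym leaf) refl

  leafIndicator-internal : ∀ {a} → IsInternal S a → leafIndicator S a ≡ 0
  leafIndicator-internal {a} = zero-test (outdeg S a)
    where
    zero-test : ∀ k → k ≢ 0 → indicator S ⌊ k ℕ.≟ 0 ⌋ ≡ 0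
    zero-test zero    k≢0 = ⊥-elim (k≢0 refl)
    zero-test (suc _) _   = refl

  leafIndicator≤1 : ∀ a → leafIndicator S a ≤ 1
  leafIndicator≤1 a = bounded (outdeg S a)
    where
    bounded : ∀ k → indicator S ⌊ k ℕ.≟ 0 ⌋ ≤ 1
    bounded zero    = ≤-refl
    bounded (suc _) = z≤n

leafIndicator-cong : ∀ {n} (S S′ : ArcSet n) {a b} → outdeg S a ≡ outdeg S′ b →
                     leafIndicator S a ≡ leafIndicator S′ b
leafIndicator-cong S S′ e =
  trans (cong (λ k → indicator S ⌊ k ℕ.≟ 0 ⌋) e) (indicator-irrelevant S S′ _)

module _ {n} {T : ArcSet n} (parents : UniqueParents T) {u v p : Fin n}
         (pv : T p v ≡ true) (p≢u : p ≢ u) where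

  private
    T′ = oneChange T u v

  leaves-oneChange : leaves T + (leafIndicator T′ u + leafIndicator T′ p) ≡
                     leaves T′ + (leafIndicator T u + leafIndicator T p)
  leaves-oneChange =
    sum-update₂ (leafIndicator T) (leafIndicator T′) (allFin⁺ n) (∈-allFin u) (∈-allFin p)
                (p≢u ∘ sym) same
    where
    same : ∀ {a} → a ∈ allFin n → a ≢ u → a ≢ p → leafIndicator T a ≡ leafIndicator T′ a
    same _ a≢u a≢p = leafIndicator-cong T T′
      (sym (outdeg-oneChange T u v a≢u (¬-not λ av → a≢p (parents av pv))))

  private
    ℓ ℓ′ : Fin n → ℕ
    ℓ  = leafIndicator T
    ℓ′ = leafIndicator T′

    ℓp≡0 : ℓ p ≡ 0
    ℓp≡0 = leafIndicator-internal T (outdeg-≢0 {S = T} pv)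

    ℓ′u≡0 : ℓ′ u ≡ 0
    ℓ′u≡0 = leafIndicator-internal T′ (outdeg-≢0 {S = T′} (oneChange-new T u v))

    outdeg-p : outdeg T p ≡ suc (outdeg T′ p)
    outdeg-p = outdeg-oneChange-parent T u v p≢u pv

  leaves-oneChange-< : IsLeaf T u → outdeg T p ≢ 1 → leaves T′ < leaves T
  leaves-oneChange-< u-leaf p-branching = ≤-reflexive (begin
    suc (leaves T′)           ≡⟨ +-comm 1 (leaves T′) ⟩
    leaves T′ + (1 + 0)       ≡⟨ cong₂ (λ x y → leaves T′ + (x + y)) ℓu≡1 ℓp≡0 ⟨
    leaves T′ + (ℓ u + ℓ p)   ≡⟨ leaves-oneChange ⟨
    leaves T + (ℓ′ u + ℓ′ p)  ≡⟨ cong₂ (λ x y → leaves T + (x + y)) ℓ′u≡0 ℓ′p≡0 ⟩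
    leaves T + 0              ≡⟨ +-identityʳ _ ⟩
    leaves T                  ∎)
    where
    open ≡-Reasoning
    ℓu≡1 : ℓ u ≡ 1
    ℓu≡1 = leafIndicator-leaf T u-leaf
    ℓ′p≡0 : ℓ′ p ≡ 0
    ℓ′p≡0 = leafIndicator-internal T′ λ p′-leaf → p-branching (trans outdeg-p (cong suc p′-leaf))

  leaves-oneChange-≥ : IsInternal T u ⊎ outdeg T p ≡ 1 → leaves T ≤ leaves T′
  leaves-oneChange-≥ u-internal⊎p-unary =
    +-cancelʳ-≤ (ℓ′ p) (leaves T) (leaves T′) (begin
      leaves T + ℓ′ p            ≤⟨ +-monoʳ-≤ (leaves T) (m≤n+m (ℓ′ p) (ℓ′ u)) ⟩
      leaves T + (ℓ′ u + ℓ′ p)   ≡⟨ leaves-oneChange ⟩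
      leaves T′ + (ℓ u + ℓ p)    ≡⟨ cong (λ y → leaves T′ + (ℓ u + y)) ℓp≡0 ⟩
      leaves T′ + (ℓ u + 0)      ≡⟨ cong (leaves T′ +_) (+-identityʳ (ℓ u)) ⟩
      leaves T′ + ℓ u            ≤⟨ +-monoʳ-≤ (leaves T′) (ℓu≤ℓ′p u-internal⊎p-unary) ⟩
      leaves T′ + ℓ′ p           ∎)
    where
    open ≤-Reasoning
    ℓu≤ℓ′p : IsInternal T u ⊎ outdeg T p ≡ 1 → ℓ u ≤ ℓ′ p
    ℓu≤ℓ′p (inj₁ u-internal) = subst (_≤ ℓ′ p) (sym (leafIndicator-internal T u-internal)) z≤n
    ℓu≤ℓ′p (inj₂ p-unary)    =
      subst (ℓ u ≤_) (sym (leafIndicator-leaf T′ p′-leaf)) (leafIndicator≤1 T u)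
      where
      p′-leaf : IsLeaf T′ p
      p′-leaf = suc-injective (trans (sym outdeg-p) p-unary)

arc-irreflexive : ∀ {n} (D : Digraph n) {u v} → arc D u v ≡ true → u ≢ v
arc-irreflexive D uv refl with trans (sym uv) (loopless D _)
... | ()

module _ {n} {D : Digraph n} {T : ArcSet n} (T-branching : IsOutBranching D T) where

  private
    A : Arborescence T
    A = outBranching⇒arborescence {D = D} T-branching
    open Arborescence A

  oneChange-outBranching : ∀ {u v} → arc D u v ≡ true → ¬ Path T v u → v ≢ root →
                           IsOutBranching D (oneChange T u v)
  oneChange-outBranching {u} {v} uv v↛u v≢root =
    arborescence⇒outBranching {D = D} T′⊆D (oneChange-arborescence A v↛u v≢root)
    where
    T′⊆D : ∀ a b → oneChange T u v a b ≡ true → arc D a b ≡ true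
    T′⊆D a b ab with oneChange-arc T u v {a} {b} ab
    ... | inj₁ (refl , refl) = uv
    ... | inj₂ (_ , ab′)     = proj₁ T-branching a b ab′

  ¬backward⇒¬above : ∀ {u v} → arc D u v ≡ true → ¬ IsBackward T u v → ¬ Path T v u
  ¬backward⇒¬above uv not-backward v⇝u = not-backward (arc-irreflexive D uv ∘ sym , v⇝u)

  minimal⇒condition : Minimal D T → Condition D T
  minimal⇒condition minimal u v uv uv∉T not-backward
    with v↛u ← ¬backward⇒¬above uv not-backward
    with p , pv ← parent-of-nonroot A (¬above⇒≢root A v↛u)
    with outdeg T u ℕ.≟ 0
  ... | no u-internal = inj₁ u-internal
  ... | yes u-leaf with outdeg T p ℕ.≟ 1
  ...   | yes p-unary    = inj₂ (p , pv , p-unary)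
  ...   | no p-branching =
    ⊥-elim (minimal u v uv uv∉T (oneChange-outBranching uv v↛u (¬above⇒≢root A v↛u))
              (leaves-oneChange-< parent-unique pv (arc≢nonarc {S = T} pv uv∉T) u-leaf p-branching))

  condition⇒minimal : Condition D T → Minimal D T
  condition⇒minimal condition u v uv uv∉T T′-branching fewer
    with A′ ← outBranching⇒arborescence {D = D} T′-branching
    with p , pv ← parent-of-nonroot A (oneChange-arborescence⇒≢root A′ A) =
    <⇒≱ fewer (leaves-oneChange-≥ parent-unique pv (arc≢nonarc {S = T} pv uv∉T)
                 (unary-parent (condition u v uv uv∉T (oneChange-arborescence⇒¬above A′ ∘ proj₂))))
    where
    unary-parent : IsInternal T u ⊎ (Σ _ λ q → (T q v ≡ true) × (outdeg T q ≡ 1)) →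
                   IsInternal T u ⊎ outdeg T p ≡ 1
    unary-parent (inj₁ u-internal)         = inj₁ u-internal
    unary-parent (inj₂ (q , qv , q-unary)) =
      inj₂ (subst (λ x → outdeg T x ≡ 1) (parent-unique qv pv) q-unary)

lemma1 : (n : ℕ) (D : Digraph n) (T : ArcSet n) → IsOutBranching D T →
    (Minimal D T ⇔ Condition D T)
lemma1 n D T T-branching =
  mk⇔ (minimal⇒condition {D = D} T-branching) (condition⇒minimal {D = D} T-branching)
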